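{- Let $L\subseteq\mathbf{Z}_2^n$ be a linear binary code and let $A=I^n/L$ be the underlying multigraph of $I^n_c/L$. Then: (1) $A$ has a loop if and only if $L$ contains a bitstring of weight $1$, and $A$ has a double edge if and only if $L$ contains a bitstring of weight $2$. (2) $A$ can be ranked if and only if $A$ is bipartite, and this holds if and only if $L$ is an even code.
   Context: A code is a $\mathbf{Z}_2$-subspace of $\mathbf{Z}_2^n$; the weight of a bitstring is its number of $1$'s; $L$ is even if all elements have even weight. With $e_i$ the $i$-th standard basis vector, $I^n_c/L$ is the edge-colored multigraph with vertex set $\mathbf{Z}_2^n/L$ having, for each coset $C$ and each color $i\in[n]$, an edge of color $i$ joining $C$ and $C+e_i$ (one per unordered pair and color; a loop if $e_i\in L$; edges of different colors between the same two vertices are distinct, parallel edges). $A$ can be ranked if there is a function $h\colon V(A)\to\mathbf{Z}$ with $|h(u)-h(w)|=1$ for every edge $\{u,w\}$ of $A$ (so that $A$ is the Hasse diagram of a ranked poset). -}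

module Defs where

open import Data.Nat using (ℕ; zero; suc; _+_)
open import Data.Nat.Divisibility using (_∣_)
open import Data.Bool using (Bool; true; false; _xor_; if_then_else_)
open import Data.Fin using (Fin)
open import Data.Fin.Properties using (_≟_)
open import Data.Vec using (Vec; zipWith; replicate; tabulate; foldr)
open import Data.Integer using (ℤ; _-_; ∣_∣)
open import Data.Product using (Σ; ∃; _×_; _,_; proj₁; proj₂)
open import Data.Sum using (_⊎_)
open import Relation.Nullary using (¬_; ⌊_⌋)
open import Relation.Binary.PropositionalEquality using (_≡_; _≢_)

BitString : ℕ → Set
BitString n = Vec Bool n

_⊕_ : ∀ {n} → BitString n → BitString n → BitString n
_⊕_ = zipWith _xor_

𝟎 : ∀ {n} → BitString n
𝟎 = replicate _ false

e : ∀ {n} → Fin n → BitString n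
e i = tabulate (λ j → ⌊ i ≟ j ⌋)

weight : ∀ {n} → BitString n → ℕ
weight = foldr _ (λ b k → (if b then 1 else 0) + k) 0

-- A (linear binary) code: a Z₂-subspace of Z₂ⁿ
-- (over Z₂, subspace = contains 0 and closed under addition).
record Code (n : ℕ) : Set₁ where
  field
    _∈L    : BitString n → Set
    zero∈  : 𝟎 ∈L
    ⊕-closed : ∀ {x y} → x ∈L → y ∈L → (x ⊕ y) ∈L
open Code public

IsEven : ∀ {n} → Code n → Set
IsEven L = ∀ x → _∈L L x → 2 ∣ weight x

HasWeight : ∀ {n} → Code n → ℕ → Set
HasWeight L k = Σ (BitString _) λ x → _∈L L x × weight x ≡ k

-- Multigraphs whose vertex set is given as a type modulo an equivalence
-- (used to represent the quotient Z₂ⁿ/L by representatives), whose edge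
-- set is likewise a type modulo an equivalence, with endpoint maps.

record Multigraph : Set₁ where
  field
    Vertex : Set
    _≈_    : Vertex → Vertex → Set
    Edge   : Set
    _≈E_   : Edge → Edge → Set
    end₁   : Edge → Vertex
    end₂   : Edge → Vertex
open Multigraph public

SameEnds : (A : Multigraph) → Edge A → Edge A → Set
SameEnds A f g =
  (_≈_ A (end₁ A f) (end₁ A g) × _≈_ A (end₂ A f) (end₂ A g))
  ⊎ (_≈_ A (end₁ A f) (end₂ A g) × _≈_ A (end₂ A f) (end₁ A g))

HasLoop : Multigraph → Set
HasLoop A = Σ (Edge A) λ f → _≈_ A (end₁ A f) (end₂ A f)

HasDoubleEdge : Multigraph → Set
HasDoubleEdge A =
  Σ (Edge A) λ f → Σ (Edge A) λ g → ¬ (_≈E_ A f g) × SameEnds A f g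

CanBeRanked : Multigraph → Set
CanBeRanked A =
  Σ (Vertex A → ℤ) λ h →
    (∀ u v → _≈_ A u v → h u ≡ h v) ×
    (∀ f → ∣ h (end₁ A f) - h (end₂ A f) ∣ ≡ 1)

Bipartite : Multigraph → Set
Bipartite A =
  Σ (Vertex A → Bool) λ c →
    (∀ u v → _≈_ A u v → c u ≡ c v) ×
    (∀ f → c (end₁ A f) ≢ c (end₂ A f))

-- Vertices: cosets of L, represented by bitstrings
-- u with u ≈ w iff u ⊕ w ∈ L.  Edges: for each coset C and colour i an
-- edge {C, C + eᵢ}, represented by a pair (u , i); two representatives
-- give the same edge iff they have the same colour and the same unordered
-- pair of endpoints, i.e. u ≈ u' or u ≈ u' ⊕ eᵢ.  Edges of different
-- colours are always distinct.

I/ : (n : ℕ) → Code n → Multigraph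
I/ n L = record
  { Vertex = BitString n
  ; _≈_    = λ u w → _∈L L (u ⊕ w)
  ; Edge   = BitString n × Fin n
  ; _≈E_   = λ { (u , i) (u' , i') →
                   i ≡ i' × (_∈L L (u ⊕ u') ⊎ _∈L L (u ⊕ (u' ⊕ e i))) }
  ; end₁   = λ { (u , i) → u }
  ; end₂   = λ { (u , i) → u ⊕ e i }
  }

-- A loop at the coset C is an edge of some colour i with C + eᵢ = C, i.e. eᵢ ∈ L.
-- Two parallel edges of colours i ≠ j at C give C + eᵢ = C + eⱼ, i.e. eᵢ + eⱼ ∈ L,
-- and an edge can only be parallel to one of its own colour if it is the same edge.
-- A ranking reduced mod 2 is a 2-colouring, and a 2-colouring read as 0/1 is a
-- ranking.  Finally, a proper 2-colouring of the cube Qₙ is, up to a constant, the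
-- parity of the weight; it descends to Z₂ⁿ/L exactly when all of L has even weight.
module Submission where

open import Defs
open import Algebra.Bundles using (CommutativeRing)
import Algebra.Properties.CommutativeSemigroup as CommutativeSemigroupProperties
import Algebra.Properties.AbelianGroup as AbelianGroupProperties
open import Data.Bool using (Bool; true; false; not; _xor_; if_then_else_)
open import Data.Bool.Properties
  using (not-involutive; not-injective; not-¬; ¬-not; xor-same; xor-assoc; xor-comm;
         xor-identityˡ; xor-identityʳ; xor-annihilates-not; not-distribˡ-xor;
         not-distribʳ-xor; xor-∧-commutativeRing)
open import Data.Empty using (⊥-elim)
open import Data.Fin using (Fin; zero; suc)
open import Data.Fin.Properties using (_≟_; suc-injective)
open import Data.Integer as ℤ using (ℤ; +_; -[1+_]; ∣_∣; _⊖_)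
import Data.Integer.Properties as ℤ
open import Data.Nat using (ℕ; zero; suc; pred; _+_; _*_)
open import Data.Nat.Divisibility using (_∣_; divides)
open import Data.Product using (Σ; _×_; _,_; proj₁)
open import Data.Sum using (inj₁; inj₂)
open import Data.Vec using ([]; _∷_; tabulate)
open import Data.Vec.Properties
  using (tabulate-cong; zipWith-assoc; zipWith-comm; zipWith-identityˡ; zipWith-identityʳ)
open import Function using (_∘_)
open import Function.Bundles using (_⇔_; mk⇔)
open import Relation.Nullary using (yes; no; ⌊_⌋)
open import Relation.Binary.PropositionalEquality
open ≡-Reasoning

open CommutativeSemigroupProperties
  (CommutativeRing.+-commutativeSemigroup xor-∧-commutativeRing)
  using (interchange)
open AbelianGroupProperties ℤ.+-0-abelianGroup using (//-rightDividesˡ)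

odd : ℕ → Bool
odd zero    = false
odd (suc k) = not (odd k)

odd-+ : ∀ m n → odd (m + n) ≡ odd m xor odd n
odd-+ zero    n = refl
odd-+ (suc m) n = trans (cong not (odd-+ m n)) (not-distribˡ-xor (odd m) (odd n))

2∣⇒odd≡false : ∀ {k} → 2 ∣ k → odd k ≡ false
2∣⇒odd≡false (divides q refl) = odd-double q
  where
  odd-double : ∀ q → odd (q * 2) ≡ false
  odd-double zero    = refl
  odd-double (suc q) = trans (not-involutive (odd (q * 2))) (odd-double q)

odd≡false⇒2∣ : ∀ k → odd k ≡ false → 2 ∣ k
odd≡true⇒2∣suc : ∀ k → odd k ≡ true → 2 ∣ suc k

odd≡false⇒2∣ zero    _ = divides 0 refl
odd≡false⇒2∣ (suc k) p = odd≡true⇒2∣suc k (not-injective p)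

odd≡true⇒2∣suc zero    ()
odd≡true⇒2∣suc (suc k) p with odd≡false⇒2∣ k (not-injective p)
... | divides q k≡2q = divides (suc q) (cong (λ m → 2 + m) k≡2q)

xor≡false⇒≡ : ∀ {x y} → x xor y ≡ false → x ≡ y
xor≡false⇒≡ {false} p = sym p
xor≡false⇒≡ {true}  p = sym (not-injective p)

oddℤ : ℤ → Bool
oddℤ z = odd ∣ z ∣

odd-∣⊖∣ : ∀ m n → odd ∣ m ⊖ n ∣ ≡ odd m xor odd n
odd-∣⊖∣ m       zero    = sym (xor-identityʳ (odd m))
odd-∣⊖∣ zero    (suc n) = refl
odd-∣⊖∣ (suc m) (suc n) = begin
  odd ∣ suc m ⊖ suc n ∣        ≡⟨ cong (odd ∘ ∣_∣) (ℤ.[1+m]⊖[1+n]≡m⊖n m n) ⟩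
  odd ∣ m ⊖ n ∣                ≡⟨ odd-∣⊖∣ m n ⟩
  odd m xor odd n              ≡⟨ xor-annihilates-not (odd m) (odd n) ⟨
  odd (suc m) xor odd (suc n)  ∎

oddℤ-+ : ∀ a b → oddℤ (a ℤ.+ b) ≡ oddℤ a xor oddℤ b
oddℤ-+ (+ m)    (+ n)    = odd-+ m n
oddℤ-+ (+ m)    -[1+ n ] = odd-∣⊖∣ m (suc n)
oddℤ-+ -[1+ m ] (+ n)    = trans (odd-∣⊖∣ n (suc m)) (xor-comm (odd n) (odd (suc m)))
oddℤ-+ -[1+ m ] -[1+ n ] = begin
  odd (suc (suc (m + n)))      ≡⟨ not-involutive (odd (m + n)) ⟩
  odd (m + n)                  ≡⟨ odd-+ m n ⟩
  odd m xor odd n              ≡⟨ xor-annihilates-not (odd m) (odd n) ⟨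
  odd (suc m) xor odd (suc n)  ∎

∣a-b∣≡1⇒oddℤ-flips : ∀ a b → ∣ a ℤ.- b ∣ ≡ 1 → oddℤ a ≡ not (oddℤ b)
∣a-b∣≡1⇒oddℤ-flips a b ∣a-b∣≡1 = begin
  oddℤ a                       ≡⟨ cong oddℤ (//-rightDividesˡ b a) ⟨
  oddℤ (a ℤ.- b ℤ.+ b)         ≡⟨ oddℤ-+ (a ℤ.- b) b ⟩
  odd ∣ a ℤ.- b ∣ xor oddℤ b   ≡⟨ cong (λ k → odd k xor oddℤ b) ∣a-b∣≡1 ⟩
  not (oddℤ b)                 ∎

bitℤ : Bool → ℤ
bitℤ b = if b then + 1 else + 0

≢⇒∣bitℤ-bitℤ∣≡1 : ∀ x y → x ≢ y → ∣ bitℤ x ℤ.- bitℤ y ∣ ≡ 1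
≢⇒∣bitℤ-bitℤ∣≡1 true  true  x≢y = ⊥-elim (x≢y refl)
≢⇒∣bitℤ-bitℤ∣≡1 true  false _   = refl
≢⇒∣bitℤ-bitℤ∣≡1 false true  _   = refl
≢⇒∣bitℤ-bitℤ∣≡1 false false x≢y = ⊥-elim (x≢y refl)

ranked⇔bipartite : (A : Multigraph) → CanBeRanked A ⇔ Bipartite A
ranked⇔bipartite A = mk⇔ ranked⇒bipartite bipartite⇒ranked
  where
  ranked⇒bipartite : CanBeRanked A → Bipartite A
  ranked⇒bipartite (h , h-wd , h-edge) =
    oddℤ ∘ h ,
    (λ u v u≈v → cong oddℤ (h-wd u v u≈v)) ,
    (λ f same → not-¬ same
       (∣a-b∣≡1⇒oddℤ-flips (h (end₁ A f)) (h (end₂ A f)) (h-edge f)))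

  bipartite⇒ranked : Bipartite A → CanBeRanked A
  bipartite⇒ranked (c , c-wd , c-edge) =
    bitℤ ∘ c ,
    (λ u v u≈v → cong bitℤ (c-wd u v u≈v)) ,
    (λ f → ≢⇒∣bitℤ-bitℤ∣≡1 (c (end₁ A f)) (c (end₂ A f)) (c-edge f))

module _ {n : ℕ} where

  ⊕-assoc : (x y z : BitString n) → (x ⊕ y) ⊕ z ≡ x ⊕ (y ⊕ z)
  ⊕-assoc = zipWith-assoc xor-assoc

  ⊕-comm : (x y : BitString n) → x ⊕ y ≡ y ⊕ x
  ⊕-comm = zipWith-comm xor-comm

  ⊕-identityˡ : (x : BitString n) → 𝟎 ⊕ x ≡ x
  ⊕-identityˡ = zipWith-identityˡ xor-identityˡ

  ⊕-identityʳ : (x : BitString n) → x ⊕ 𝟎 ≡ x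
  ⊕-identityʳ = zipWith-identityʳ xor-identityʳ

⊕-self : ∀ {n} (x : BitString n) → x ⊕ x ≡ 𝟎
⊕-self []      = refl
⊕-self (b ∷ x) = cong₂ _∷_ (xor-same b) (⊕-self x)

⊕-interchange : ∀ {n} (w x y z : BitString n) → (w ⊕ x) ⊕ (y ⊕ z) ≡ (w ⊕ y) ⊕ (x ⊕ z)
⊕-interchange []      []      []      []      = refl
⊕-interchange (a ∷ w) (b ∷ x) (c ∷ y) (d ∷ z) =
  cong₂ _∷_ (interchange a b c d) (⊕-interchange w x y z)

⊕-cancelˡ : ∀ {n} (x y : BitString n) → x ⊕ (x ⊕ y) ≡ y
⊕-cancelˡ x y = begin
  x ⊕ (x ⊕ y)  ≡⟨ ⊕-assoc x x y ⟨
  (x ⊕ x) ⊕ y  ≡⟨ cong (_⊕ y) (⊕-self x) ⟩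
  𝟎 ⊕ y        ≡⟨ ⊕-identityˡ y ⟩
  y            ∎

odd-weight-∷ : ∀ {n} b (u : BitString n) → odd (weight (b ∷ u)) ≡ b xor odd (weight u)
odd-weight-∷ true  u = refl
odd-weight-∷ false u = refl

odd-weight-⊕ : ∀ {n} (u v : BitString n) →
               odd (weight (u ⊕ v)) ≡ odd (weight u) xor odd (weight v)
odd-weight-⊕ []      []      = refl
odd-weight-⊕ (a ∷ u) (b ∷ v) = begin
  odd (weight ((a xor b) ∷ (u ⊕ v)))  ≡⟨ odd-weight-∷ (a xor b) (u ⊕ v) ⟩
  (a xor b) xor odd (weight (u ⊕ v))  ≡⟨ cong ((a xor b) xor_) (odd-weight-⊕ u v) ⟩
  (a xor b) xor (p xor q)             ≡⟨ interchange a b p q ⟩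
  (a xor p) xor (b xor q)             ≡⟨ cong₂ _xor_ (odd-weight-∷ a u) (odd-weight-∷ b v) ⟨
  odd (weight (a ∷ u)) xor odd (weight (b ∷ v))  ∎
  where
  p = odd (weight u)
  q = odd (weight v)

e-zero : ∀ {n} → e {suc n} zero ≡ true ∷ 𝟎
e-zero {n} = cong (true ∷_) (tabulate-false n)
  where
  tabulate-false : ∀ n → tabulate {n = n} (λ j → ⌊ zero ≟ suc j ⌋) ≡ 𝟎
  tabulate-false zero    = refl
  tabulate-false (suc n) = cong (false ∷_) (tabulate-false n)

e-suc : ∀ {n} (i : Fin n) → e (suc i) ≡ false ∷ e i
e-suc i = cong (false ∷_) (tabulate-cong ≟-suc)
  where
  ≟-suc : ∀ j → ⌊ suc i ≟ suc j ⌋ ≡ ⌊ i ≟ j ⌋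
  ≟-suc j with i ≟ j
  ... | yes _ = refl
  ... | no  _ = refl

weight-𝟎 : ∀ n → weight (𝟎 {n}) ≡ 0
weight-𝟎 zero    = refl
weight-𝟎 (suc n) = weight-𝟎 n

weight-e : ∀ {n} (i : Fin n) → weight (e i) ≡ 1
weight-e {suc n} zero    = trans (cong weight (e-zero {n})) (cong suc (weight-𝟎 n))
weight-e         (suc i) = trans (cong weight (e-suc i)) (weight-e i)

weight-e⊕e : ∀ {n} {i j : Fin n} → i ≢ j → weight (e i ⊕ e j) ≡ 2
weight-e⊕e {suc n} {zero}  {zero}  i≢j = ⊥-elim (i≢j refl)
weight-e⊕e {suc n} {zero}  {suc j} _   = begin
  weight (e zero ⊕ e (suc j))          ≡⟨ cong₂ (λ x y → weight (x ⊕ y)) (e-zero {n}) (e-suc j) ⟩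
  suc (weight (𝟎 ⊕ e j))               ≡⟨ cong (suc ∘ weight) (⊕-identityˡ (e j)) ⟩
  suc (weight (e j))                   ≡⟨ cong suc (weight-e j) ⟩
  2                                    ∎
weight-e⊕e {suc n} {suc i} {zero}  i≢j =
  trans (cong weight (⊕-comm (e (suc i)) (e zero))) (weight-e⊕e (i≢j ∘ sym))
weight-e⊕e {suc n} {suc i} {suc j} i≢j = begin
  weight (e (suc i) ⊕ e (suc j))       ≡⟨ cong₂ (λ x y → weight (x ⊕ y)) (e-suc i) (e-suc j) ⟩
  weight (e i ⊕ e j)                   ≡⟨ weight-e⊕e (i≢j ∘ cong suc) ⟩
  2                                    ∎

weight≡0⇒𝟎 : ∀ {n} (x : BitString n) → weight x ≡ 0 → x ≡ 𝟎
weight≡0⇒𝟎 []          _ = refl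
weight≡0⇒𝟎 (false ∷ x) p = cong (false ∷_) (weight≡0⇒𝟎 x p)

weight≡1⇒e : ∀ {n} (x : BitString n) → weight x ≡ 1 → Σ (Fin n) λ i → x ≡ e i
weight≡1⇒e {suc n} (true ∷ x) p =
  zero , trans (cong (true ∷_) (weight≡0⇒𝟎 x (cong pred p))) (sym (e-zero {n}))
weight≡1⇒e (false ∷ x) p with weight≡1⇒e x p
... | i , x≡eᵢ = suc i , trans (cong (false ∷_) x≡eᵢ) (sym (e-suc i))

weight≡2⇒e⊕e : ∀ {n} (x : BitString n) → weight x ≡ 2 →
               Σ (Fin n) λ i → Σ (Fin n) λ j → i ≢ j × x ≡ e i ⊕ e j
weight≡2⇒e⊕e {suc n} (true ∷ x) p with weight≡1⇒e x (cong pred p)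
... | j , x≡eⱼ = zero , suc j , (λ ()) , (begin
  true ∷ x                    ≡⟨ cong (true ∷_) (trans x≡eⱼ (sym (⊕-identityˡ (e j)))) ⟩
  (true ∷ 𝟎) ⊕ (false ∷ e j)  ≡⟨ cong₂ _⊕_ (e-zero {n}) (e-suc j) ⟨
  e zero ⊕ e (suc j)          ∎)
weight≡2⇒e⊕e (false ∷ x) p with weight≡2⇒e⊕e x p
... | i , j , i≢j , x≡eᵢ⊕eⱼ = suc i , suc j , i≢j ∘ suc-injective , (begin
  false ∷ x                      ≡⟨ cong (false ∷_) x≡eᵢ⊕eⱼ ⟩
  (false ∷ e i) ⊕ (false ∷ e j)  ≡⟨ cong₂ _⊕_ (e-suc i) (e-suc j) ⟨
  e (suc i) ⊕ e (suc j)          ∎)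

IsProper2Colouring : ∀ {n} → (BitString n → Bool) → Set
IsProper2Colouring c = ∀ u i → c u ≢ c (u ⊕ e i)

odd-weight-flips : ∀ {n} (u : BitString n) i → odd (weight (u ⊕ e i)) ≡ not (odd (weight u))
odd-weight-flips u i = begin
  odd (weight (u ⊕ e i))                ≡⟨ odd-weight-⊕ u (e i) ⟩
  odd (weight u) xor odd (weight (e i)) ≡⟨ cong (λ k → odd (weight u) xor odd k) (weight-e i) ⟩
  odd (weight u) xor true               ≡⟨ xor-comm (odd (weight u)) true ⟩
  not (odd (weight u))                  ∎

odd-weight-isProper : ∀ {n} → IsProper2Colouring {n} (odd ∘ weight)
odd-weight-isProper u i same = not-¬ refl (trans same (odd-weight-flips u i))

isProper-face : ∀ {n} (c : BitString (suc n) → Bool) →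
                IsProper2Colouring c → IsProper2Colouring (c ∘ (false ∷_))
isProper-face c c-proper v i =
  subst (λ eᵢ → c (false ∷ v) ≢ c ((false ∷ v) ⊕ eᵢ)) (e-suc i) (c-proper (false ∷ v) (suc i))

isProper⇒parity : ∀ {n} (c : BitString n → Bool) → IsProper2Colouring c →
                  ∀ u → c 𝟎 xor c u ≡ odd (weight u)
isProper⇒parity {zero}  c _        []          = xor-same (c [])
isProper⇒parity {suc n} c c-proper (false ∷ u) =
  isProper⇒parity (c ∘ (false ∷_)) (isProper-face c c-proper) u
isProper⇒parity {suc n} c c-proper (true ∷ u)  = begin
  c 𝟎 xor c (true ∷ u)              ≡⟨ cong (λ w → c 𝟎 xor c w) flip-head ⟨
  c 𝟎 xor c ((false ∷ u) ⊕ e zero)  ≡⟨ cong (c 𝟎 xor_) (¬-not (c-proper (false ∷ u) zero ∘ sym)) ⟩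
  c 𝟎 xor not (c (false ∷ u))       ≡⟨ not-distribʳ-xor (c 𝟎) (c (false ∷ u)) ⟨
  not (c 𝟎 xor c (false ∷ u))       ≡⟨ cong not face-parity ⟩
  not (odd (weight u))              ∎
  where
  flip-head : (false ∷ u) ⊕ e zero ≡ true ∷ u
  flip-head = trans (cong ((false ∷ u) ⊕_) (e-zero {n})) (cong (true ∷_) (⊕-identityʳ u))

  face-parity : c 𝟎 xor c (false ∷ u) ≡ odd (weight u)
  face-parity = isProper⇒parity (c ∘ (false ∷_)) (isProper-face c c-proper) u

module Cosets {n : ℕ} (L : Code n) where

  infix 4 _∼_
  _∼_ : BitString n → BitString n → Set
  u ∼ w = _∈L L (u ⊕ w)

  ∼-refl : ∀ u → u ∼ u
  ∼-refl u = subst (_∈L L) (sym (⊕-self u)) (zero∈ L)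

  ∼-⊕ : ∀ {u u′ v v′} → u ∼ u′ → v ∼ v′ → (u ⊕ v) ∼ (u′ ⊕ v′)
  ∼-⊕ {u} {u′} {v} {v′} u∼u′ v∼v′ =
    subst (_∈L L) (sym (⊕-interchange u v u′ v′)) (⊕-closed L u∼u′ v∼v′)

  ∼-translate⇒∈ : ∀ u x → u ∼ u ⊕ x → _∈L L x
  ∼-translate⇒∈ u x = subst (_∈L L) (⊕-cancelˡ u x)

  ∈⇒∼-translate : ∀ u x → _∈L L x → u ∼ u ⊕ x
  ∈⇒∼-translate u x = subst (_∈L L) (sym (⊕-cancelˡ u x))

  loop⇔weight1 : HasLoop (I/ n L) ⇔ HasWeight L 1
  loop⇔weight1 = mk⇔ loop⇒weight1 weight1⇒loop
    where
    loop⇒weight1 : HasLoop (I/ n L) → HasWeight L 1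
    loop⇒weight1 ((u , i) , loop) = e i , ∼-translate⇒∈ u (e i) loop , weight-e i

    weight1⇒loop : HasWeight L 1 → HasLoop (I/ n L)
    weight1⇒loop (x , x∈L , wt) with weight≡1⇒e x wt
    ... | i , refl = (𝟎 , i) , ∈⇒∼-translate 𝟎 (e i) x∈L

  parallel⇒eᵢ∼eⱼ : ∀ {u u′ i j} → SameEnds (I/ n L) (u , i) (u′ , j) → e i ∼ e j
  parallel⇒eᵢ∼eⱼ {u} {u′} {i} {j} (inj₁ (u∼u′ , uᵢ∼u′ⱼ)) =
    subst₂ _∼_ (⊕-cancelˡ u (e i)) (⊕-cancelˡ u′ (e j)) (∼-⊕ u∼u′ uᵢ∼u′ⱼ)
  parallel⇒eᵢ∼eⱼ {u} {u′} {i} {j} (inj₂ (u∼u′ⱼ , uᵢ∼u′)) =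
    subst₂ _∼_ (⊕-cancelˡ u (e i)) (trans (⊕-comm (u′ ⊕ e j) u′) (⊕-cancelˡ u′ (e j)))
      (∼-⊕ u∼u′ⱼ uᵢ∼u′)

  sameColour-parallel⇒≈E : ∀ {u u′ i} → SameEnds (I/ n L) (u , i) (u′ , i) →
                         _≈E_ (I/ n L) (u , i) (u′ , i)
  sameColour-parallel⇒≈E (inj₁ (u∼u′ , _))  = refl , inj₁ u∼u′
  sameColour-parallel⇒≈E (inj₂ (u∼u′ᵢ , _)) = refl , inj₂ u∼u′ᵢ

  doubleEdge⇔weight2 : HasDoubleEdge (I/ n L) ⇔ HasWeight L 2
  doubleEdge⇔weight2 = mk⇔ doubleEdge⇒weight2 weight2⇒doubleEdge
    where
    doubleEdge⇒weight2 : HasDoubleEdge (I/ n L) → HasWeight L 2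
    doubleEdge⇒weight2 ((u , i) , (u′ , j) , distinct , parallel) with i ≟ j
    ... | yes refl = ⊥-elim (distinct (sameColour-parallel⇒≈E parallel))
    ... | no  i≢j  = e i ⊕ e j , parallel⇒eᵢ∼eⱼ parallel , weight-e⊕e i≢j

    weight2⇒doubleEdge : HasWeight L 2 → HasDoubleEdge (I/ n L)
    weight2⇒doubleEdge (x , x∈L , wt) with weight≡2⇒e⊕e x wt
    ... | i , j , i≢j , refl =
      (𝟎 , i) , (𝟎 , j) , i≢j ∘ proj₁ ,
      inj₁ (∼-refl 𝟎 , subst₂ _∼_ (sym (⊕-identityˡ (e i))) (sym (⊕-identityˡ (e j))) x∈L)

  bipartite⇔even : Bipartite (I/ n L) ⇔ IsEven L
  bipartite⇔even = mk⇔ bipartite⇒even even⇒bipartite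
    where
    bipartite⇒even : Bipartite (I/ n L) → IsEven L
    bipartite⇒even (c , c-wd , c-edge) x x∈L = odd≡false⇒2∣ (weight x) (begin
      odd (weight x)  ≡⟨ isProper⇒parity c (λ u i → c-edge (u , i)) x ⟨
      c 𝟎 xor c x     ≡⟨ cong (_xor c x) (c-wd 𝟎 x 𝟎∼x) ⟩
      c x xor c x     ≡⟨ xor-same (c x) ⟩
      false           ∎)
      where
      𝟎∼x : 𝟎 ∼ x
      𝟎∼x = subst (_∈L L) (sym (⊕-identityˡ x)) x∈L

    even⇒bipartite : IsEven L → Bipartite (I/ n L)
    even⇒bipartite even =
      odd ∘ weight ,
      (λ u v u∼v → xor≡false⇒≡
         (trans (sym (odd-weight-⊕ u v)) (2∣⇒odd≡false (even (u ⊕ v) u∼v)))) ,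
      (λ { (u , i) → odd-weight-isProper u i })

mainTheorem6 : (n : ℕ) (L : Code n) →
    ((HasLoop (I/ n L) ⇔ HasWeight L 1) × (HasDoubleEdge (I/ n L) ⇔ HasWeight L 2))
    × ((CanBeRanked (I/ n L) ⇔ Bipartite (I/ n L)) × (Bipartite (I/ n L) ⇔ IsEven L))
mainTheorem6 n L =
  (loop⇔weight1 , doubleEdge⇔weight2) , (ranked⇔bipartite (I/ n L) , bipartite⇔even)
  where open Cosets L
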